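{- Let $I=(A,C,U,(k_t)_{t},(x_t)_{t},(y_a)_{a\in A})$ be an instance of PE-GCSE such that there is at least one agent $a\in A$ with $y_a>0$ having at least one fingerprint with at least $y_a$ non-empty entries. Then $I$ is a yes-instance if and only if, for any agent $a\in A$ with $y_a>0$ having at least one fingerprint with at least $y_a$ non-empty entries, at least one of the instances $I^1,\dots,I^p$ is a yes-instance, where $X^1,\dots,X^p$ are all the fingerprints of $a$ with at least $y_a$ non-empty entries and, for each $q\in\{1,\dots,p\}$, $I^q=(A',C,U',(k'_t)_t,(x'_t)_t,(y'_{a'})_{a'\in A'})$ with $A'=A\setminus\{a\}$, $U'=(u'_1,\dots,u'_\tau)$ where $u'_t=u_t-u_t(a)$, and for each $t\in\{1,\dots,\tau\}$: $x'_t=x_t-|\{a''\in A: u_t(a'')=X^q_t \text{ and } X^q_t\neq\emptyset\}|$, $k'_t=k_t-|X^q_t|$; and for each $a'\in A'$: $y'_{a'}=y_{a'}-\sum_{t=1}^{\tau}|u_t(a')\cap X^q_t|$.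
   Context: Pre-Elected Egalitarian Committee Sequence Election (PE-GCSE): given a set $A$ of agents, a set $C$ of candidates, nomination profiles $U=(u_1,\dots,u_\tau)$ with $u_t\colon A\to C\cup\{\emptyset\}$ (agent $a$ nominates $u_t(a)$ in level $t$, or nobody if $u_t(a)=\emptyset$), integers $k_t,x_t$ for each level $t\in\{1,\dots,\tau\}$ and integers $y_a$ for each agent $a\in A$ (these integers may be negative), decide whether there exist $C_1,\dots,C_\tau\subseteq C$ with $|C_t|\leq k_t$ for every $t$ such that $|\{a\in A: u_t(a)\in C_t\}|\geq x_t$ for every $t$ and $\sum_{t=1}^{\tau}|u_t(a)\cap C_t|\geq y_a$ for every $a\in A$. Here $u_t(a)$ is viewed as a set of size at most one. A fingerprint of agent $a$ is a tuple $X=(X_1,\dots,X_\tau)\in\{u_1(a),\emptyset\}\times\dots\times\{u_\tau(a),\emptyset\}$ (each $X_t$ a set of size at most one); its non-empty entries are the $t$ with $X_t\neq\emptyset$. For $A'=A\setminus\{a\}$, the function $u_t-u_t(a)\colon A'\to C\cup\{\emptyset\}$ maps $a'$ to $u_t(a')\setminus u_t(a)$, i.e., to $u_t(a')$ if $u_t(a')\neq u_t(a)$ and to $\emptyset$ otherwise. -}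

module Defs where

open import Data.Nat using (ℕ; zero; suc)
open import Data.Integer using (ℤ; +_; _-_; _≤_; _<_)
open import Data.Bool using (Bool; true; false; if_then_else_; _∧_; not)
open import Data.Fin using (Fin; zero; suc; punchIn; _≟_)
open import Data.Fin.Subset using (Subset; ∣_∣)
open import Data.Vec using (lookup)
open import Data.Maybe using (Maybe; just; nothing; is-just)
open import Data.Product using (Σ; _×_; ∃)
open import Relation.Binary.PropositionalEquality using (_≡_)
open import Data.Sum using (_⊎_)
open import Relation.Nullary.Decidable using (⌊_⌋)
open import Function using (_∘_)

count : ∀ {n} → (Fin n → Bool) → ℕ
count {zero}  f = 0
count {suc n} f = (if f zero then 1 else 0) Data.Nat.+ count (f ∘ suc)

eqM : ∀ {m} → Maybe (Fin m) → Maybe (Fin m) → Bool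
eqM nothing  nothing  = true
eqM (just c) (just d) = ⌊ c ≟ d ⌋
eqM _        _        = false

-- |u ∩ X| for sets u, X of size at most one (as Maybe)
capSize : ∀ {m} → Maybe (Fin m) → Maybe (Fin m) → ℕ
capSize (just c) (just d) = if ⌊ c ≟ d ⌋ then 1 else 0
capSize _        _        = 0

size : ∀ {m} → Maybe (Fin m) → ℕ
size nothing  = 0
size (just _) = 1

memb : ∀ {m} → Maybe (Fin m) → Subset m → Bool
memb nothing  S = false
memb (just c) S = lookup S c

-- PE-GCSE instance: agents Fin n, candidates Fin m, levels Fin τ
record Instance (n m τ : ℕ) : Set where
  field
    u : Fin τ → Fin n → Maybe (Fin m)
    k : Fin τ → ℤ
    x : Fin τ → ℤ
    y : Fin n → ℤ

open Instance public

IsSolution : ∀ {n m τ} → Instance n m τ → (Fin τ → Subset m) → Set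
IsSolution {n} {m} {τ} I C =
    (∀ t → + ∣ C t ∣ ≤ k I t)
  × (∀ t → x I t ≤ + count (λ a → memb (u I t a) (C t)))
  × (∀ a → y I a ≤ + count (λ t → memb (u I t a) (C t)))

YesInstance : ∀ {n m τ} → Instance n m τ → Set
YesInstance {n} {m} {τ} I = Σ (Fin τ → Subset m) (IsSolution I)

IsFingerprint : ∀ {n m τ} → Instance n m τ → Fin n → (Fin τ → Maybe (Fin m)) → Set
IsFingerprint I a X = ∀ t → (X t ≡ nothing) ⊎ (X t ≡ u I t a)

nonEmpty : ∀ {m τ} → (Fin τ → Maybe (Fin m)) → ℕ
nonEmpty X = count (λ t → is-just (X t))

IsBigFingerprint : ∀ {n m τ} → Instance n m τ → Fin n → (Fin τ → Maybe (Fin m)) → Set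
IsBigFingerprint I a X = IsFingerprint I a X × (y I a ≤ + nonEmpty X)

minusM : ∀ {m} → Maybe (Fin m) → Maybe (Fin m) → Maybe (Fin m)
minusM v w = if eqM v w then nothing else v

-- the instance I^X obtained by removing agent a (A' = A ∖ {a} ≅ Fin n via punchIn a)
reduce : ∀ {n m τ} → Instance (suc n) m τ → Fin (suc n) → (Fin τ → Maybe (Fin m))
       → Instance n m τ
reduce I a X = record
  { u = λ t a' → minusM (u I t (punchIn a a')) (u I t a)
  ; k = λ t → k I t - + size (X t)
  ; x = λ t → x I t - + count (λ a'' → eqM (u I t a'') (X t) ∧ is-just (X t))
  ; y = λ a' → y I (punchIn a a') - + sumL (λ t → capSize (u I t (punchIn a a')) (X t))
  }
  where
  sumL : ∀ {τ'} → (Fin τ' → ℕ) → ℕ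
  sumL {zero}   f = 0
  sumL {suc τ'} f = f zero Data.Nat.+ sumL (f ∘ suc)

{-# OPTIONS --safe #-}
-- Fix an agent a. A solution C of I induces the fingerprint X_t = u_t(a) ∩ C_t, which has at
-- least y_a non-empty entries because a is satisfied, and C_t ∖ X_t solves I^X: an agent loses
-- representation at level t only if it nominated X_t, which is exactly what x′_t and y′ discount,
-- and a nomination erased in U′ equals u_t(a), so it is either X_t or outside C_t anyway.
-- Conversely, if C′ solves I^X then C′_t ∪ X_t solves I, representing a at every non-empty entry
-- of X. The forward direction works for every agent; the hypothesis only supplies the agent for
-- the converse.

module Submission where

open import Defs
open import Data.Nat using (ℕ; suc)
open import Data.Integer using (ℤ; +_; _<_)
open import Data.Fin using (Fin)
open import Data.Maybe using (Maybe)
open import Data.Product using (Σ; _×_; ∃)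
open import Function.Bundles using (_⇔_)

open import Data.Nat as ℕ using (zero; z≤n)
import Data.Nat.Properties as ℕ
import Data.Integer as ℤ
import Data.Integer.Properties as ℤ
open import Data.Fin using (zero; suc; punchIn; punchOut; _≟_)
open import Data.Fin.Properties using (punchIn-punchOut)
open import Data.Fin.Subset using (Subset; ∣_∣)
open import Data.Vec using (_∷_; lookup; _[_]≔_)
open import Data.Vec.Properties using (lookup∘update; lookup∘update′)
open import Data.Maybe using (just; nothing; is-just)
open import Data.Bool using (Bool; true; false; if_then_else_; _∧_)
open import Data.Product using (_,_)
open import Data.Sum using (_⊎_; inj₁; inj₂)
open import Relation.Nullary using (yes; no)
open import Relation.Nullary.Decidable using (⌊_⌋)
open import Relation.Binary.PropositionalEquality
open import Function using (_∘_; case_of_)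
open import Function.Bundles using (mk⇔)
open import Data.Empty using (⊥-elim)
open import Algebra.Properties.CommutativeMonoid.Sum ℕ.+-0-commutativeMonoid
  using (sum; sum-remove; ∑-distrib-+; sum-cong-≗)
open import Algebra.Properties.AbelianGroup ℤ.+-0-abelianGroup
  using (//-rightDividesˡ; //-rightDividesʳ; ∙-cancelˡ)

𝟙 : Bool → ℕ
𝟙 b = if b then 1 else 0

𝟙≤1 : ∀ b → 𝟙 b ℕ.≤ 1
𝟙≤1 true  = ℕ.≤-refl
𝟙≤1 false = z≤n

count≡sum : ∀ {n} (f : Fin n → Bool) → count f ≡ sum (𝟙 ∘ f)
count≡sum {zero}  f = refl
count≡sum {suc n} f = cong (𝟙 (f zero) ℕ.+_) (count≡sum (f ∘ suc))

sum-mono-≤ : ∀ {n} {f g : Fin n → ℕ} → (∀ i → f i ℕ.≤ g i) → sum f ℕ.≤ sum g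
sum-mono-≤ {zero}  f≤g = z≤n
sum-mono-≤ {suc n} f≤g = ℕ.+-mono-≤ (f≤g zero) (sum-mono-≤ (f≤g ∘ suc))

count-mono-≤ : ∀ {n} {f g : Fin n → Bool} → (∀ i → 𝟙 (f i) ℕ.≤ 𝟙 (g i)) → count f ℕ.≤ count g
count-mono-≤ {f = f} {g} f≤g
  rewrite count≡sum f | count≡sum g = sum-mono-≤ f≤g

count-cong : ∀ {n} {f g : Fin n → Bool} → (∀ i → f i ≡ g i) → count f ≡ count g
count-cong {f = f} {g} f≗g
  rewrite count≡sum f | count≡sum g = sum-cong-≗ (cong 𝟙 ∘ f≗g)

count-≤-+ : ∀ {n} {f g h : Fin n → Bool} → (∀ i → 𝟙 (f i) ℕ.≤ 𝟙 (g i) ℕ.+ 𝟙 (h i))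
          → count f ℕ.≤ count g ℕ.+ count h
count-≤-+ {f = f} {g} {h} f≤g+h
  rewrite count≡sum f | count≡sum g | count≡sum h =
  ℕ.≤-trans (sum-mono-≤ f≤g+h) (ℕ.≤-reflexive (∑-distrib-+ (𝟙 ∘ g) (𝟙 ∘ h)))

count-+-≤ : ∀ {n} {f g h : Fin n → Bool} → (∀ i → 𝟙 (g i) ℕ.+ 𝟙 (h i) ℕ.≤ 𝟙 (f i))
          → count g ℕ.+ count h ℕ.≤ count f
count-+-≤ {f = f} {g} {h} g+h≤f
  rewrite count≡sum f | count≡sum g | count≡sum h =
  ℕ.≤-trans (ℕ.≤-reflexive (sym (∑-distrib-+ (𝟙 ∘ g) (𝟙 ∘ h)))) (sum-mono-≤ g+h≤f)

count-removeAt : ∀ {n} (f : Fin (suc n) → Bool) a → f a ≡ false → count f ≡ count (f ∘ punchIn a)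
count-removeAt f a fa≡false = begin
  count f                             ≡⟨ count≡sum f ⟩
  sum (𝟙 ∘ f)                         ≡⟨ sum-remove {i = a} (𝟙 ∘ f) ⟩
  𝟙 (f a) ℕ.+ sum (𝟙 ∘ f ∘ punchIn a) ≡⟨ cong (λ b → 𝟙 b ℕ.+ sum (𝟙 ∘ f ∘ punchIn a)) fa≡false ⟩
  sum (𝟙 ∘ f ∘ punchIn a)             ≡⟨ count≡sum (f ∘ punchIn a) ⟨
  count (f ∘ punchIn a)               ∎
  where open ≡-Reasoning

i≤p+q⇒i-p≤q : ∀ {i : ℤ} {p q} → i ℤ.≤ + (p ℕ.+ q) → i ℤ.- + p ℤ.≤ + q
i≤p+q⇒i-p≤q {i} {p} {q} i≤p+q = begin
  i ℤ.- + p               ≤⟨ ℤ.+-monoˡ-≤ (ℤ.- + p) i≤p+q ⟩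
  + (p ℕ.+ q) ℤ.- + p     ≡⟨ cong (ℤ._- + p) (trans (ℤ.pos-+ p q) (ℤ.+-comm (+ p) (+ q))) ⟩
  + q ℤ.+ + p ℤ.- + p     ≡⟨ //-rightDividesʳ (+ p) (+ q) ⟩
  + q                     ∎
  where open ℤ.≤-Reasoning

i-p≤q⇒i≤p+q : ∀ {i : ℤ} {p q} → i ℤ.- + p ℤ.≤ + q → i ℤ.≤ + (p ℕ.+ q)
i-p≤q⇒i≤p+q {i} {p} {q} i-p≤q = begin
  i                       ≡⟨ //-rightDividesˡ (+ p) i ⟨
  i ℤ.- + p ℤ.+ + p       ≤⟨ ℤ.+-monoˡ-≤ (+ p) i-p≤q ⟩
  + q ℤ.+ + p             ≡⟨ trans (ℤ.pos-+ p q) (ℤ.+-comm (+ p) (+ q)) ⟨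
  + (p ℕ.+ q)             ∎
  where open ℤ.≤-Reasoning

p+q≤i⇒p≤i-q : ∀ {i : ℤ} {p q} → + (p ℕ.+ q) ℤ.≤ i → + p ℤ.≤ i ℤ.- + q
p+q≤i⇒p≤i-q {i} {p} {q} p+q≤i = begin
  + p                     ≡⟨ //-rightDividesʳ (+ q) (+ p) ⟨
  + p ℤ.+ + q ℤ.- + q     ≡⟨ cong (ℤ._- + q) (ℤ.pos-+ p q) ⟨
  + (p ℕ.+ q) ℤ.- + q     ≤⟨ ℤ.+-monoˡ-≤ (ℤ.- + q) p+q≤i ⟩
  i ℤ.- + q               ∎
  where open ℤ.≤-Reasoning

p≤i-q⇒p+q≤i : ∀ {i : ℤ} {p q} → + p ℤ.≤ i ℤ.- + q → + (p ℕ.+ q) ℤ.≤ i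
p≤i-q⇒p+q≤i {i} {p} {q} p≤i-q = begin
  + (p ℕ.+ q)             ≡⟨ ℤ.pos-+ p q ⟩
  + p ℤ.+ + q             ≤⟨ ℤ.+-monoˡ-≤ (+ q) p≤i-q ⟩
  i ℤ.- + q ℤ.+ + q       ≡⟨ //-rightDividesˡ (+ q) i ⟩
  i                       ∎
  where open ℤ.≤-Reasoning

i-p≡i-q⇒p≡q : ∀ {i : ℤ} {p q} → i ℤ.- + p ≡ i ℤ.- + q → p ≡ q
i-p≡i-q⇒p≡q {i} eq = ℤ.+-injective (ℤ.neg-injective (∙-cancelˡ i _ _ eq))

∣S[c]≔true∣≤1+∣S∣ : ∀ {m} (S : Subset m) c → ∣ S [ c ]≔ true ∣ ℕ.≤ suc ∣ S ∣
∣S[c]≔true∣≤1+∣S∣ (true  ∷ S) zero    = ℕ.n≤1+n _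
∣S[c]≔true∣≤1+∣S∣ (false ∷ S) zero    = ℕ.≤-refl
∣S[c]≔true∣≤1+∣S∣ (true  ∷ S) (suc c) = ℕ.s≤s (∣S[c]≔true∣≤1+∣S∣ S c)
∣S[c]≔true∣≤1+∣S∣ (false ∷ S) (suc c) = ∣S[c]≔true∣≤1+∣S∣ S c

∣S[c]≔false∣+1≡∣S∣ : ∀ {m} (S : Subset m) c → lookup S c ≡ true → ∣ S [ c ]≔ false ∣ ℕ.+ 1 ≡ ∣ S ∣
∣S[c]≔false∣+1≡∣S∣ (true  ∷ S) zero    refl = ℕ.+-comm ∣ S ∣ 1
∣S[c]≔false∣+1≡∣S∣ (true  ∷ S) (suc c) Sc   = cong suc (∣S[c]≔false∣+1≡∣S∣ S c Sc)
∣S[c]≔false∣+1≡∣S∣ (false ∷ S) (suc c) Sc   = ∣S[c]≔false∣+1≡∣S∣ S c Sc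

module _ {m : ℕ} where

  matches : Maybe (Fin m) → Maybe (Fin m) → Bool
  matches v X = eqM v X ∧ is-just X

  matches-nothing : ∀ (v : Maybe (Fin m)) → matches v nothing ≡ false
  matches-nothing nothing  = refl
  matches-nothing (just _) = refl

  capSize≡𝟙-matches : ∀ (v X : Maybe (Fin m)) → capSize v X ≡ 𝟙 (matches v X)
  capSize≡𝟙-matches nothing  nothing  = refl
  capSize≡𝟙-matches nothing  (just _) = refl
  capSize≡𝟙-matches (just _) nothing  = refl
  capSize≡𝟙-matches (just c) (just d) with ⌊ c ≟ d ⌋
  ... | true  = refl
  ... | false = refl

  minusM-self : ∀ (w : Maybe (Fin m)) → minusM w w ≡ nothing
  minusM-self nothing  = refl
  minusM-self (just c) with c ≟ c
  ... | yes _   = refl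
  ... | no c≢c = ⊥-elim (c≢c refl)

  memb-minusM-≤ : ∀ (v w : Maybe (Fin m)) S → 𝟙 (memb (minusM v w) S) ℕ.≤ 𝟙 (memb v S)
  memb-minusM-≤ v w S with eqM v w
  ... | true  = z≤n
  ... | false = ℕ.≤-refl

  selected : Maybe (Fin m) → Subset m → Maybe (Fin m)
  selected nothing  S = nothing
  selected (just c) S = if lookup S c then just c else nothing

  delete : Maybe (Fin m) → Subset m → Subset m
  delete nothing  S = S
  delete (just c) S = S [ c ]≔ false

  insert : Maybe (Fin m) → Subset m → Subset m
  insert nothing  S = S
  insert (just c) S = S [ c ]≔ true

  selected-fingerprint : ∀ (w : Maybe (Fin m)) S → (selected w S ≡ nothing) ⊎ (selected w S ≡ w)
  selected-fingerprint nothing  S = inj₁ refl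
  selected-fingerprint (just c) S with lookup S c
  ... | true  = inj₂ refl
  ... | false = inj₁ refl

  memb≡is-just-selected : ∀ (w : Maybe (Fin m)) S → memb w S ≡ is-just (selected w S)
  memb≡is-just-selected nothing  S = refl
  memb≡is-just-selected (just c) S with lookup S c
  ... | true  = refl
  ... | false = refl

  ∣delete-selected∣ : ∀ (w : Maybe (Fin m)) S → ∣ delete (selected w S) S ∣ ℕ.+ size (selected w S) ≡ ∣ S ∣
  ∣delete-selected∣ nothing  S = ℕ.+-identityʳ ∣ S ∣
  ∣delete-selected∣ (just c) S with lookup S c in Sc
  ... | true  = ∣S[c]≔false∣+1≡∣S∣ S c Sc
  ... | false = ℕ.+-identityʳ ∣ S ∣

  ∣insert∣≤ : ∀ (X : Maybe (Fin m)) S → ∣ insert X S ∣ ℕ.≤ ∣ S ∣ ℕ.+ size X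
  ∣insert∣≤ nothing  S = ℕ.m≤m+n ∣ S ∣ 0
  ∣insert∣≤ (just c) S = subst (∣ S [ c ]≔ true ∣ ℕ.≤_) (ℕ.+-comm 1 ∣ S ∣) (∣S[c]≔true∣≤1+∣S∣ S c)

  split-≤ : ∀ (v w : Maybe (Fin m)) S → 𝟙 (memb v S)
          ℕ.≤ 𝟙 (matches v (selected w S)) ℕ.+ 𝟙 (memb (minusM v w) (delete (selected w S) S))
  split-≤ nothing  w        S = z≤n
  split-≤ (just d) nothing  S = ℕ.≤-refl
  split-≤ (just d) (just c) S with lookup S c in Sc
  ... | true with d ≟ c
  ...   | yes refl = 𝟙≤1 (lookup S d)
  ...   | no d≢c   rewrite lookup∘update′ d≢c S false = ℕ.≤-refl
  split-≤ (just d) (just c) S | false with d ≟ c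
  ...   | yes refl rewrite Sc = z≤n
  ...   | no _     = ℕ.≤-refl

  merge-≤ : ∀ {X w : Maybe (Fin m)} v S → (X ≡ nothing) ⊎ (X ≡ w)
          → 𝟙 (matches v X) ℕ.+ 𝟙 (memb (minusM v w) S) ℕ.≤ 𝟙 (memb v (insert X S))
  merge-≤ {X = nothing} {w} v S _ rewrite matches-nothing v = memb-minusM-≤ v w S
  merge-≤ {X = just c} v        S (inj₂ refl) with v
  ... | nothing = z≤n
  ... | just d with d ≟ c
  ...   | yes refl rewrite lookup∘update d S true = ℕ.≤-refl
  ...   | no d≢c   rewrite lookup∘update′ d≢c S true = ℕ.≤-refl

  is-just≤memb-insert : ∀ {X w : Maybe (Fin m)} S → (X ≡ nothing) ⊎ (X ≡ w)
                      → 𝟙 (is-just X) ℕ.≤ 𝟙 (memb w (insert X S))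
  is-just≤memb-insert {X = nothing} S _ = z≤n
  is-just≤memb-insert {X = just c}  S (inj₂ refl) rewrite lookup∘update c S true = ℕ.≤-refl

  count-split : ∀ {k} (v w : Fin k → Maybe (Fin m)) (S : Fin k → Subset m)
    → count (λ i → memb (v i) (S i))
      ℕ.≤ count (λ i → matches (v i) (selected (w i) (S i)))
          ℕ.+ count (λ i → memb (minusM (v i) (w i)) (delete (selected (w i) (S i)) (S i)))
  count-split v w S = count-≤-+ (λ i → split-≤ (v i) (w i) (S i))

  count-merge : ∀ {k} {X w : Fin k → Maybe (Fin m)} (v : Fin k → Maybe (Fin m)) (S : Fin k → Subset m)
    → (∀ i → (X i ≡ nothing) ⊎ (X i ≡ w i))
    → count (λ i → matches (v i) (X i)) ℕ.+ count (λ i → memb (minusM (v i) (w i)) (S i))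
      ℕ.≤ count (λ i → memb (v i) (insert (X i) (S i)))
  count-merge v S X-fp = count-+-≤ (λ i → merge-≤ (v i) (S i) (X-fp i))

  count-minusM-removeAt : ∀ {n} (v : Fin (suc n) → Maybe (Fin m)) a S
    → count (λ b → memb (minusM (v b) (v a)) S) ≡ count (λ a′ → memb (minusM (v (punchIn a a′)) (v a)) S)
  count-minusM-removeAt v a S =
    count-removeAt (λ b → memb (minusM (v b) (v a)) S) a (cong (λ w → memb w S) (minusM-self (v a)))

  level-split : ∀ {n} (v : Fin (suc n) → Maybe (Fin m)) a S
    → count (λ b → memb (v b) S)
      ℕ.≤ count (λ b → matches (v b) (selected (v a) S))
          ℕ.+ count (λ a′ → memb (minusM (v (punchIn a a′)) (v a)) (delete (selected (v a) S) S))
  level-split v a S = ℕ.≤-trans (count-split v (λ _ → v a) (λ _ → S))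
    (ℕ.≤-reflexive (cong (count (λ b → matches (v b) (selected (v a) S)) ℕ.+_)
                         (count-minusM-removeAt v a (delete (selected (v a) S) S))))

  level-merge : ∀ {n} {X} (v : Fin (suc n) → Maybe (Fin m)) a S → (X ≡ nothing) ⊎ (X ≡ v a)
    → count (λ b → matches (v b) X) ℕ.+ count (λ a′ → memb (minusM (v (punchIn a a′)) (v a)) S)
      ℕ.≤ count (λ b → memb (v b) (insert X S))
  level-merge {X = X} v a S X-fp = ℕ.≤-trans
    (ℕ.≤-reflexive (cong (count (λ b → matches (v b) X) ℕ.+_) (sym (count-minusM-removeAt v a S))))
    (count-merge v (λ _ → S) (λ _ → X-fp))

-- The sum in the agent quotas of `reduce` is a local function, so it is related to `count` by
-- induction on the number of levels, through the instance with its first level dropped.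
reduce-y : ∀ {n m τ} (I : Instance (suc n) m τ) a X a′
  → y (reduce I a X) a′ ≡ y I (punchIn a a′) ℤ.- + count (λ t → matches (u I t (punchIn a a′)) (X t))
reduce-y {τ = zero}  I a X a′ = refl
reduce-y {n} {m} {suc τ} I a X a′ = cong (λ s → y I (punchIn a a′) ℤ.- + s)
  (cong₂ ℕ._+_ (capSize≡𝟙-matches (u I zero (punchIn a a′)) (X zero))
               (i-p≡i-q⇒p≡q {y I (punchIn a a′)} (reduce-y I⁺ a (X ∘ suc) a′)))
  where
  I⁺ : Instance (suc n) m τ
  I⁺ = record { u = u I ∘ suc ; k = k I ∘ suc ; x = x I ∘ suc ; y = y I }

module _ {n m τ} (I : Instance (suc n) m τ) (a : Fin (suc n)) where

  trace : (Fin τ → Subset m) → Fin τ → Maybe (Fin m)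
  trace C t = selected (u I t a) (C t)

  withoutTrace : (Fin τ → Subset m) → Fin τ → Subset m
  withoutTrace C t = delete (trace C t) (C t)

  withFingerprint : (Fin τ → Maybe (Fin m)) → (Fin τ → Subset m) → Fin τ → Subset m
  withFingerprint X C′ t = insert (X t) (C′ t)

  trace-isBigFingerprint : ∀ {C} → IsSolution I C → IsBigFingerprint I a (trace C)
  trace-isBigFingerprint {C} (_ , _ , agents) =
      (λ t → selected-fingerprint (u I t a) (C t))
    , subst (λ c → y I a ℤ.≤ + c) (count-cong (λ t → memb≡is-just-selected (u I t a) (C t))) (agents a)

  withoutTrace-solution : ∀ {C} → IsSolution I C → IsSolution (reduce I a (trace C)) (withoutTrace C)
  withoutTrace-solution {C} (sizes , levels , agents) = sizes′ , levels′ , agents′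
    where
    sizes′ : ∀ t → + ∣ withoutTrace C t ∣ ℤ.≤ k I t ℤ.- + size (trace C t)
    sizes′ t = p+q≤i⇒p≤i-q (subst (λ s → + s ℤ.≤ k I t) (sym (∣delete-selected∣ (u I t a) (C t))) (sizes t))
    levels′ : ∀ t → x (reduce I a (trace C)) t
                    ℤ.≤ + count (λ a′ → memb (u (reduce I a (trace C)) t a′) (withoutTrace C t))
    levels′ t = i≤p+q⇒i-p≤q (ℤ.≤-trans (levels t) (ℤ.+≤+ (level-split (λ b → u I t b) a (C t))))
    agents′ : ∀ a′ → y (reduce I a (trace C)) a′
                     ℤ.≤ + count (λ t → memb (u (reduce I a (trace C)) t a′) (withoutTrace C t))
    agents′ a′ = ℤ.≤-trans (ℤ.≤-reflexive (reduce-y I a (trace C) a′)) (i≤p+q⇒i-p≤q (ℤ.≤-trans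
      (agents (punchIn a a′)) (ℤ.+≤+ (count-split (λ t → u I t (punchIn a a′)) (λ t → u I t a) C))))

  withFingerprint-solution : ∀ {X C′} → IsBigFingerprint I a X → IsSolution (reduce I a X) C′
                           → IsSolution I (withFingerprint X C′)
  withFingerprint-solution {X} {C′} (X-fp , big) (sizes′ , levels′ , agents′) = sizes , levels , agents
    where
    sizes : ∀ t → + ∣ withFingerprint X C′ t ∣ ℤ.≤ k I t
    sizes t = ℤ.≤-trans (ℤ.+≤+ (∣insert∣≤ (X t) (C′ t))) (p≤i-q⇒p+q≤i (sizes′ t))
    levels : ∀ t → x I t ℤ.≤ + count (λ b → memb (u I t b) (withFingerprint X C′ t))
    levels t = ℤ.≤-trans (i-p≤q⇒i≤p+q (levels′ t)) (ℤ.+≤+ (level-merge (λ b → u I t b) a (C′ t) (X-fp t)))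
    others : ∀ a′ → y I (punchIn a a′) ℤ.≤ + count (λ t → memb (u I t (punchIn a a′)) (withFingerprint X C′ t))
    others a′ = ℤ.≤-trans (i-p≤q⇒i≤p+q (ℤ.≤-trans (ℤ.≤-reflexive (sym (reduce-y I a X a′))) (agents′ a′)))
      (ℤ.+≤+ (count-merge (λ t → u I t (punchIn a a′)) C′ X-fp))
    agents : ∀ b → y I b ℤ.≤ + count (λ t → memb (u I t b) (withFingerprint X C′ t))
    agents b with b ≟ a
    ... | yes refl = ℤ.≤-trans big (ℤ.+≤+ (count-mono-≤ (λ t → is-just≤memb-insert (C′ t) (X-fp t))))
    ... | no b≢a   = subst (λ b → y I b ℤ.≤ + count (λ t → memb (u I t b) (withFingerprint X C′ t)))
                       (punchIn-punchOut (b≢a ∘ sym)) (others (punchOut (b≢a ∘ sym)))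

mainTheorem14 : ∀ {n m τ : ℕ} (I : Instance (suc n) m τ)
    → Σ (Fin (suc n)) (λ a → (+ 0 < y I a) × ∃ (λ X → IsBigFingerprint I a X))
    → YesInstance I
      ⇔ (∀ (a : Fin (suc n)) → + 0 < y I a → ∃ (λ X → IsBigFingerprint I a X)
           → Σ (Fin τ → Maybe (Fin m)) (λ X → IsBigFingerprint I a X × YesInstance (reduce I a X)))
mainTheorem14 I (a₀ , y-pos , big-exists) = mk⇔
  (λ (C , sol) a _ _ →
    trace I a C , trace-isBigFingerprint I a sol , withoutTrace I a C , withoutTrace-solution I a sol)
  (λ reducible → case reducible a₀ y-pos big-exists of λ where
    (X , big , C′ , sol′) → withFingerprint I a₀ X C′ , withFingerprint-solution I a₀ big sol′)
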